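{- Let $F=\mathbb Q(\sqrt2)$, $R=\mathbb Z[\sqrt2]$, $q=\sqrt2$, and for $n\ge1$ let $U_n=(R/q^nR)^\times$. If $n\le4$, then $U_n$ is generated by the images of the units of $R$, and hence there is no nontrivial Hecke character $\psi$ of $F$ with $\psi_\infty$ trivial and conductor dividing $q^n$. If $n>4$, then: (1) $U_n$ is the direct sum of the cyclic subgroups generated by the images of $1+q$, $-1$ and $3+4q$; (2) $1+q$ has order $2^{\lfloor n/2\rfloor}$ and $3+4q$ has order $2^{\lfloor (n-3)/2\rfloor}$ in $U_n$; (3) with $k=\lfloor n/2\rfloor$ and $l=\lfloor (n-3)/2\rfloor$, $U_n\cong(\mathbb Z/2^k\mathbb Z)\oplus(\mathbb Z/2^l\mathbb Z)\oplus(\mathbb Z/2\mathbb Z)$.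
   Context: Hecke characters are finite order characters of $F_{\mathbf A}^\times/F^\times$, $\psi_\infty=\prod_{v\mid\infty}\psi_v$; the conductor is the finite conductor. A finite order Hecke character with trivial $\psi_\infty$ and conductor dividing an ideal $\mathfrak m$ corresponds to a character of $(R/\mathfrak m)^\times$ trivial on the image of the unit group of $R$. -}

module Defs where

open import Level using (_⊔_)
open import Data.Nat using (ℕ; zero; suc; _+_; NonZero)
open import Data.Nat using () renaming (_<_ to _<ℕ_; _≤_ to _≤ℕ_)
open import Data.Integer.Divisibility using () renaming (_∣_ to _∣ℤ_)
open import Data.Integer as ℤ using (ℤ; +_; -[1+_])
open import Data.List using (List; []; _∷_)
open import Data.List.Relation.Unary.All using (All)
open import Data.Product using (Σ; ∃; _×_; _,_)
open import Relation.Binary.PropositionalEquality using (_≡_)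
open import Algebra.Bundles using (Group)

-- The ring R = ℤ[√2]; an element ⟨ a , b ⟩ stands for a + b√2.

record ℤ√2 : Set where
  constructor ⟨_,_⟩
  field
    re : ℤ
    im : ℤ
open ℤ√2 public

infixl 6 _+ᴿ_ _-ᴿ_
infixl 7 _*ᴿ_
infixr 8 _^ᴿ_

_+ᴿ_ : ℤ√2 → ℤ√2 → ℤ√2
⟨ a , b ⟩ +ᴿ ⟨ c , d ⟩ = ⟨ a ℤ.+ c , b ℤ.+ d ⟩

-ᴿ_ : ℤ√2 → ℤ√2
-ᴿ ⟨ a , b ⟩ = ⟨ ℤ.- a , ℤ.- b ⟩

_-ᴿ_ : ℤ√2 → ℤ√2 → ℤ√2
x -ᴿ y = x +ᴿ (-ᴿ y)

-- (a + b√2)(c + d√2) = (ac + 2bd) + (ad + bc)√2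
_*ᴿ_ : ℤ√2 → ℤ√2 → ℤ√2
⟨ a , b ⟩ *ᴿ ⟨ c , d ⟩ = ⟨ a ℤ.* c ℤ.+ (+ 2) ℤ.* (b ℤ.* d) , a ℤ.* d ℤ.+ b ℤ.* c ⟩

0ᴿ 1ᴿ : ℤ√2
0ᴿ = ⟨ + 0 , + 0 ⟩
1ᴿ = ⟨ + 1 , + 0 ⟩

_^ᴿ_ : ℤ√2 → ℕ → ℤ√2
x ^ᴿ zero = 1ᴿ
x ^ᴿ suc n = x *ᴿ (x ^ᴿ n)

q : ℤ√2
q = ⟨ + 0 , + 1 ⟩

g₁ g₂ g₃ : ℤ√2
g₁ = ⟨ + 1 , + 1 ⟩
g₂ = ⟨ -[1+ 0 ] , + 0 ⟩
g₃ = ⟨ + 3 , + 4 ⟩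

product : List ℤ√2 → ℤ√2
product [] = 1ᴿ
product (x ∷ xs) = x *ᴿ product xs

IsUnitR : ℤ√2 → Set
IsUnitR x = ∃ λ y → x *ᴿ y ≡ 1ᴿ

infix 4 _≡_[modq^_]
_≡_[modq^_] : ℤ√2 → ℤ√2 → ℕ → Set
x ≡ y [modq^ n ] = ∃ λ r → x -ᴿ y ≡ (q ^ᴿ n) *ᴿ r

IsUnitMod : ℕ → ℤ√2 → Set
IsUnitMod n x = ∃ λ y → (x *ᴿ y) ≡ 1ᴿ [modq^ n ]

HasOrderMod : ℕ → ℤ√2 → ℕ → Set
HasOrderMod n g d =
  _<ℕ_ 0 d × (g ^ᴿ d) ≡ 1ᴿ [modq^ n ] ×
  (∀ m → _<ℕ_ 0 m → (g ^ᴿ m) ≡ 1ᴿ [modq^ n ] → _≤ℕ_ d m)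

-- A character of U_n with values in a group G that is trivial on the
-- image of the units of R; represented by a function on representatives.

IsCharTrivialOnUnits : ∀ {c ℓ} (n : ℕ) (G : Group c ℓ) → (ℤ√2 → Group.Carrier G) → Set ℓ
IsCharTrivialOnUnits n G χ =
  (∀ x y → IsUnitMod n x → x ≡ y [modq^ n ] → χ x ≈ χ y) ×
  (∀ x y → IsUnitMod n x → IsUnitMod n y → χ (x *ᴿ y) ≈ (χ x ∙ χ y)) ×
  (∀ u → IsUnitR u → χ u ≈ ε)
  where open Group G

-- Z/2^k ⊕ Z/2^l ⊕ Z/2, represented by triples of naturals with
-- componentwise equality of residues.

_≡ℕ_[mod_] : ℕ → ℕ → ℕ → Set
a ≡ℕ b [mod m ] = (+ m) ∣ℤ ((+ a) ℤ.- (+ b))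

_≡ₜ_[mod_,_,_] : ℕ × ℕ × ℕ → ℕ × ℕ × ℕ → (A B C : ℕ) → Set
(a , b , c) ≡ₜ (a′ , b′ , c′) [mod A , B , C ] =
  (a ≡ℕ a′ [mod A ]) × (b ≡ℕ b′ [mod B ]) × (c ≡ℕ c′ [mod C ])

_+ₜ_ : ℕ × ℕ × ℕ → ℕ × ℕ × ℕ → ℕ × ℕ × ℕ
(a , b , c) +ₜ (a′ , b′ , c′) = (a + a′ , b + b′ , c + c′)

-- Write v(x) for the q-adic valuation of x − 1. If v(x) = m ≥ 1 then v(x²) ≥ m + 1, with
-- v(x²) = m + 2 as soon as m ≥ 3 (because 2 = q²); hence v((1+q)^(2^t)) = 1, 2, 5, 7, 9, … and
-- v((3+4q)^(2^t)) = 2, 6, 8, 10, …, and odd powers of x agree with x modulo q^(m+1). Reading off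
-- when these levels reach n gives the orders 2^⌊n/2⌋ and 2^⌊(n−3)/2⌋. For generation, a unit
-- congruent to h modulo q^m is congruent modulo q^(m+1) to h or to h·w, for any w with v(w) = m,
-- and products of the generators attain every level (levels 1, 2, 3 already with the global
-- units 1+q and −1). Independence is a finite computation modulo q⁵; from q^n to q^(n+1) only
-- one of the orders of 1+q and 3+4q doubles, so a relation modulo q^(n+1) forces the two factors
-- of stable order, and then the third, to be trivial.

module Submission where

open import Defs
open import Data.Nat using (ℕ; _≤_; _<_; _^_; _∸_; _/_)
open import Data.Product using (∃; _×_)
open import Data.List.Relation.Unary.All using (All)
open import Function.Bundles using (_⇔_)
open import Algebra.Bundles using (Group)

open import Algebra.Bundles using (CommutativeRing)
import Algebra.Properties.CommutativeSemiring.Exp as CommutativeSemiringExp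
open import Algebra.Structures using (IsCommutativeRing)
open import Data.Empty using (⊥-elim)
open import Data.Integer as ℤ using (+_; -[1+_]; ∣_∣)
open import Data.Integer.DivMod using (_%ℕ_; _/ℕ_; a≡a%ℕn+[a/ℕn]*n; n%ℕd<d)
open import Data.Integer.Divisibility using () renaming (_∣_ to _∣ℤ_)
import Data.Integer.Divisibility.Signed as ℤ∣
import Data.Integer.Properties as ℤP
import Data.Integer.Tactic.RingSolver as ℤ-Solver
open import Data.List using ([]; _∷_; _++_)
open import Data.List.Relation.Unary.All using ([]; _∷_)
open import Data.List.Relation.Unary.All.Properties using (++⁺)
open import Data.Maybe using (just; nothing)
open import Data.Nat using (zero; suc; _+_; _*_; _%_; z≤n; s≤s; NonZero; >-nonZero)
open import Data.Nat.DivMod using (m≡m%n+[m/n]*n; m%n<n; +-distrib-/-∣ʳ; m*n/n≡m)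
open import Data.Nat.Divisibility using (_∣_; divides; _∣?_; 1∣_; m∣m*n; ∣⇒≤; m%n≡0⇒n∣m)
import Data.Nat.Properties as ℕP
open import Data.Product using (_,_; proj₁; proj₂)
open import Data.Sum as Sum using (_⊎_; inj₁; inj₂)
open import Function.Bundles using (mk⇔)
open import Level using (0ℓ)
open import Relation.Binary.Bundles using (Setoid)
open import Relation.Binary.PropositionalEquality
import Relation.Binary.Reasoning.Setoid as SetoidReasoning
open import Relation.Nullary using (¬_)
open import Relation.Nullary.Decidable using (False; toWitnessFalse; _×-dec_)
open import Tactic.RingSolver using (solve-∀)
open import Tactic.RingSolver.Core.AlmostCommutativeRing
  using (AlmostCommutativeRing; fromCommutativeRing)

ℤ√2-isCommutativeRing : IsCommutativeRing _≡_ _+ᴿ_ _*ᴿ_ (λ x → -ᴿ x) 0ᴿ 1ᴿ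
ℤ√2-isCommutativeRing = record
  { isRing = record
    { +-isAbelianGroup = record
      { isGroup = record
        { isMonoid = record
          { isSemigroup = record
            { isMagma = record { isEquivalence = isEquivalence ; ∙-cong = cong₂ _+ᴿ_ }
            ; assoc = λ x y z → cong₂ ⟨_,_⟩ (ℤP.+-assoc (re x) _ _) (ℤP.+-assoc (im x) _ _) }
          ; identity = (λ x → cong₂ ⟨_,_⟩ (ℤP.+-identityˡ (re x)) (ℤP.+-identityˡ (im x)))
                     , (λ x → cong₂ ⟨_,_⟩ (ℤP.+-identityʳ (re x)) (ℤP.+-identityʳ (im x))) }
        ; inverse = (λ x → cong₂ ⟨_,_⟩ (ℤP.+-inverseˡ (re x)) (ℤP.+-inverseˡ (im x)))
                  , (λ x → cong₂ ⟨_,_⟩ (ℤP.+-inverseʳ (re x)) (ℤP.+-inverseʳ (im x)))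
        ; ⁻¹-cong = cong (λ x → -ᴿ x) }
      ; comm = λ x y → cong₂ ⟨_,_⟩ (ℤP.+-comm (re x) (re y)) (ℤP.+-comm (im x) (im y)) }
    ; *-cong = cong₂ _*ᴿ_
    ; *-assoc = λ { ⟨ a , b ⟩ ⟨ c , d ⟩ ⟨ e , f ⟩ →
        cong₂ ⟨_,_⟩ (re-assoc a b c d e f) (im-assoc a b c d e f) }
    ; *-identity = (λ { ⟨ a , b ⟩ → cong₂ ⟨_,_⟩ (re-identityˡ a b) (im-identityˡ a b) })
                 , (λ { ⟨ a , b ⟩ → cong₂ ⟨_,_⟩ (re-identityʳ a b) (im-identityʳ a b) })
    ; distrib = (λ { ⟨ a , b ⟩ ⟨ c , d ⟩ ⟨ e , f ⟩ →
                     cong₂ ⟨_,_⟩ (re-distribˡ a b c d e f) (im-distribˡ a b c d e f) })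
              , (λ { ⟨ a , b ⟩ ⟨ c , d ⟩ ⟨ e , f ⟩ →
                     cong₂ ⟨_,_⟩ (re-distribʳ a b c d e f) (im-distribʳ a b c d e f) }) }
  ; *-comm = λ { ⟨ a , b ⟩ ⟨ c , d ⟩ → cong₂ ⟨_,_⟩ (re-comm a b c d) (im-comm a b c d) } }
  where
  re-assoc : ∀ a b c d e f →
             (a ℤ.* c ℤ.+ + 2 ℤ.* (b ℤ.* d)) ℤ.* e ℤ.+ + 2 ℤ.* ((a ℤ.* d ℤ.+ b ℤ.* c) ℤ.* f)
             ≡ a ℤ.* (c ℤ.* e ℤ.+ + 2 ℤ.* (d ℤ.* f)) ℤ.+ + 2 ℤ.* (b ℤ.* (c ℤ.* f ℤ.+ d ℤ.* e))
  re-assoc = ℤ-Solver.solve-∀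
  im-assoc : ∀ a b c d e f → (a ℤ.* c ℤ.+ + 2 ℤ.* (b ℤ.* d)) ℤ.* f ℤ.+ (a ℤ.* d ℤ.+ b ℤ.* c) ℤ.* e
                           ≡ a ℤ.* (c ℤ.* f ℤ.+ d ℤ.* e) ℤ.+ b ℤ.* (c ℤ.* e ℤ.+ + 2 ℤ.* (d ℤ.* f))
  im-assoc = ℤ-Solver.solve-∀
  re-identityˡ : ∀ a b → + 1 ℤ.* a ℤ.+ + 2 ℤ.* (+ 0 ℤ.* b) ≡ a
  re-identityˡ = ℤ-Solver.solve-∀
  im-identityˡ : ∀ a b → + 1 ℤ.* b ℤ.+ + 0 ℤ.* a ≡ b
  im-identityˡ = ℤ-Solver.solve-∀
  re-identityʳ : ∀ a b → a ℤ.* + 1 ℤ.+ + 2 ℤ.* (b ℤ.* + 0) ≡ a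
  re-identityʳ = ℤ-Solver.solve-∀
  im-identityʳ : ∀ a b → a ℤ.* + 0 ℤ.+ b ℤ.* + 1 ≡ b
  im-identityʳ = ℤ-Solver.solve-∀
  re-distribˡ : ∀ a b c d e f → a ℤ.* (c ℤ.+ e) ℤ.+ + 2 ℤ.* (b ℤ.* (d ℤ.+ f))
                              ≡ (a ℤ.* c ℤ.+ + 2 ℤ.* (b ℤ.* d)) ℤ.+ (a ℤ.* e ℤ.+ + 2 ℤ.* (b ℤ.* f))
  re-distribˡ = ℤ-Solver.solve-∀
  im-distribˡ : ∀ a b c d e f → a ℤ.* (d ℤ.+ f) ℤ.+ b ℤ.* (c ℤ.+ e)
                              ≡ (a ℤ.* d ℤ.+ b ℤ.* c) ℤ.+ (a ℤ.* f ℤ.+ b ℤ.* e)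
  im-distribˡ = ℤ-Solver.solve-∀
  re-distribʳ : ∀ a b c d e f → (c ℤ.+ e) ℤ.* a ℤ.+ + 2 ℤ.* ((d ℤ.+ f) ℤ.* b)
                              ≡ (c ℤ.* a ℤ.+ + 2 ℤ.* (d ℤ.* b)) ℤ.+ (e ℤ.* a ℤ.+ + 2 ℤ.* (f ℤ.* b))
  re-distribʳ = ℤ-Solver.solve-∀
  im-distribʳ : ∀ a b c d e f → (c ℤ.+ e) ℤ.* b ℤ.+ (d ℤ.+ f) ℤ.* a
                              ≡ (c ℤ.* b ℤ.+ d ℤ.* a) ℤ.+ (e ℤ.* b ℤ.+ f ℤ.* a)
  im-distribʳ = ℤ-Solver.solve-∀
  re-comm : ∀ a b c d → a ℤ.* c ℤ.+ + 2 ℤ.* (b ℤ.* d) ≡ c ℤ.* a ℤ.+ + 2 ℤ.* (d ℤ.* b)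
  re-comm = ℤ-Solver.solve-∀
  im-comm : ∀ a b c d → a ℤ.* d ℤ.+ b ℤ.* c ≡ c ℤ.* b ℤ.+ d ℤ.* a
  im-comm = ℤ-Solver.solve-∀

ℤ√2-commutativeRing : CommutativeRing 0ℓ 0ℓ
ℤ√2-commutativeRing = record { isCommutativeRing = ℤ√2-isCommutativeRing }

ℤ√2-ring : AlmostCommutativeRing 0ℓ 0ℓ
ℤ√2-ring = fromCommutativeRing ℤ√2-commutativeRing λ { ⟨ + 0 , + 0 ⟩ → just refl ; _ → nothing }

open CommutativeRing ℤ√2-commutativeRing using (*-identityˡ; *-identityʳ; *-assoc; distribˡ; zeroˡ)
module Exp = CommutativeSemiringExp (CommutativeRing.commutativeSemiring ℤ√2-commutativeRing)

^ᴿ≡Exp-^ : ∀ x n → x ^ᴿ n ≡ x Exp.^ n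
^ᴿ≡Exp-^ x zero = refl
^ᴿ≡Exp-^ x (suc n) = cong (x *ᴿ_) (^ᴿ≡Exp-^ x n)

^ᴿ-homo-* : ∀ x m n → x ^ᴿ (m + n) ≡ x ^ᴿ m *ᴿ x ^ᴿ n
^ᴿ-homo-* x m n rewrite ^ᴿ≡Exp-^ x (m + n) | ^ᴿ≡Exp-^ x m | ^ᴿ≡Exp-^ x n = Exp.^-homo-* x m n

^ᴿ-assocʳ : ∀ x m n → (x ^ᴿ m) ^ᴿ n ≡ x ^ᴿ (m * n)
^ᴿ-assocʳ x m n rewrite ^ᴿ≡Exp-^ (x ^ᴿ m) n | ^ᴿ≡Exp-^ x m | ^ᴿ≡Exp-^ x (m * n) = Exp.^-assocʳ x m n

1ᴿ^ᴿ : ∀ n → 1ᴿ ^ᴿ n ≡ 1ᴿ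
1ᴿ^ᴿ zero = refl
1ᴿ^ᴿ (suc n) = cong (1ᴿ *ᴿ_) (1ᴿ^ᴿ n)

^ᴿ-2^suc : ∀ x t → x ^ᴿ (2 ^ suc t) ≡ x ^ᴿ (2 ^ t) *ᴿ x ^ᴿ (2 ^ t)
^ᴿ-2^suc x t =
  trans (cong (x ^ᴿ_) (cong (λ m → 2 ^ t + m) (ℕP.+-identityʳ (2 ^ t)))) (^ᴿ-homo-* x (2 ^ t) (2 ^ t))

-- Congruences modulo powers of q

-- A record wrapper around x ≡ y [modq^ n ], so that x, y and n can be inferred from a proof.
infix 4 _≈_[q^_]
record _≈_[q^_] (x y : ℤ√2) (n : ℕ) : Set where
  constructor mod-q^
  field witness : x ≡ y [modq^ n ]
open _≈_[q^_] public

module _ {n : ℕ} where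

  ≈-refl : ∀ {x} → x ≈ x [q^ n ]
  ≈-refl {x} = mod-q^ (0ᴿ , x-x≡Q*0 x (q ^ᴿ n))
    where
    x-x≡Q*0 : ∀ x Q → x -ᴿ x ≡ Q *ᴿ 0ᴿ
    x-x≡Q*0 = solve-∀ ℤ√2-ring

  ≈-reflexive : ∀ {x y} → x ≡ y → x ≈ y [q^ n ]
  ≈-reflexive refl = ≈-refl

  ≈-sym : ∀ {x y} → x ≈ y [q^ n ] → y ≈ x [q^ n ]
  ≈-sym {x} {y} (mod-q^ (r , x-y≡)) = mod-q^ (-ᴿ r , (begin
    y -ᴿ x            ≡⟨ y-x≡-[x-y] x y ⟩
    -ᴿ (x -ᴿ y)       ≡⟨ cong (λ d → -ᴿ d) x-y≡ ⟩
    -ᴿ (q ^ᴿ n *ᴿ r)  ≡⟨ -[Q*r]≡Q*-r (q ^ᴿ n) r ⟩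
    q ^ᴿ n *ᴿ -ᴿ r    ∎))
    where
    open ≡-Reasoning
    y-x≡-[x-y] : ∀ x y → y -ᴿ x ≡ -ᴿ (x -ᴿ y)
    y-x≡-[x-y] = solve-∀ ℤ√2-ring
    -[Q*r]≡Q*-r : ∀ Q r → -ᴿ (Q *ᴿ r) ≡ Q *ᴿ -ᴿ r
    -[Q*r]≡Q*-r = solve-∀ ℤ√2-ring

  ≈-trans : ∀ {x y z} → x ≈ y [q^ n ] → y ≈ z [q^ n ] → x ≈ z [q^ n ]
  ≈-trans {x} {y} {z} (mod-q^ (r , x-y≡)) (mod-q^ (s , y-z≡)) = mod-q^ (r +ᴿ s , (begin
    x -ᴿ z                          ≡⟨ telescope x y z ⟩
    (x -ᴿ y) +ᴿ (y -ᴿ z)            ≡⟨ cong₂ _+ᴿ_ x-y≡ y-z≡ ⟩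
    q ^ᴿ n *ᴿ r +ᴿ q ^ᴿ n *ᴿ s      ≡⟨ distribˡ (q ^ᴿ n) r s ⟨
    q ^ᴿ n *ᴿ (r +ᴿ s)              ∎))
    where
    open ≡-Reasoning
    telescope : ∀ x y z → x -ᴿ z ≡ (x -ᴿ y) +ᴿ (y -ᴿ z)
    telescope = solve-∀ ℤ√2-ring

  +-congˡ : ∀ x {y z} → y ≈ z [q^ n ] → x +ᴿ y ≈ x +ᴿ z [q^ n ]
  +-congˡ x {y} {z} (mod-q^ (r , y-z≡)) = mod-q^ (r , trans (cancel x y z) y-z≡)
    where
    cancel : ∀ x y z → (x +ᴿ y) -ᴿ (x +ᴿ z) ≡ y -ᴿ z
    cancel = solve-∀ ℤ√2-ring

  +-cancelˡ : ∀ x {y z} → x +ᴿ y ≈ x +ᴿ z [q^ n ] → y ≈ z [q^ n ]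
  +-cancelˡ x {y} {z} (mod-q^ (r , x+y-x-z≡)) = mod-q^ (r , trans (sym (cancel x y z)) x+y-x-z≡)
    where
    cancel : ∀ x y z → (x +ᴿ y) -ᴿ (x +ᴿ z) ≡ y -ᴿ z
    cancel = solve-∀ ℤ√2-ring

  *-cong : ∀ {x y u v} → x ≈ y [q^ n ] → u ≈ v [q^ n ] → x *ᴿ u ≈ y *ᴿ v [q^ n ]
  *-cong {x} {y} {u} {v} (mod-q^ (r , x-y≡)) (mod-q^ (s , u-v≡)) = mod-q^ (r *ᴿ u +ᴿ y *ᴿ s , (begin
    x *ᴿ u -ᴿ y *ᴿ v                          ≡⟨ split x y u v ⟩
    (x -ᴿ y) *ᴿ u +ᴿ y *ᴿ (u -ᴿ v)            ≡⟨ cong₂ (λ d e → d *ᴿ u +ᴿ y *ᴿ e) x-y≡ u-v≡ ⟩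
    q ^ᴿ n *ᴿ r *ᴿ u +ᴿ y *ᴿ (q ^ᴿ n *ᴿ s)    ≡⟨ collect (q ^ᴿ n) r s u y ⟩
    q ^ᴿ n *ᴿ (r *ᴿ u +ᴿ y *ᴿ s)              ∎))
    where
    open ≡-Reasoning
    split : ∀ x y u v → x *ᴿ u -ᴿ y *ᴿ v ≡ (x -ᴿ y) *ᴿ u +ᴿ y *ᴿ (u -ᴿ v)
    split = solve-∀ ℤ√2-ring
    collect : ∀ Q r s u y → Q *ᴿ r *ᴿ u +ᴿ y *ᴿ (Q *ᴿ s) ≡ Q *ᴿ (r *ᴿ u +ᴿ y *ᴿ s)
    collect = solve-∀ ℤ√2-ring

  *-congˡ : ∀ x {u v} → u ≈ v [q^ n ] → x *ᴿ u ≈ x *ᴿ v [q^ n ]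
  *-congˡ x = *-cong (≈-refl {x})

  *-congʳ : ∀ {x y} u → x ≈ y [q^ n ] → x *ᴿ u ≈ y *ᴿ u [q^ n ]
  *-congʳ u x≈y = *-cong x≈y (≈-refl {u})

  ^-cong : ∀ {x y} a → x ≈ y [q^ n ] → x ^ᴿ a ≈ y ^ᴿ a [q^ n ]
  ^-cong zero    x≈y = ≈-refl
  ^-cong (suc a) x≈y = *-cong x≈y (^-cong a x≈y)

≈-weaken : ∀ {m n x y} → m ≤ n → x ≈ y [q^ n ] → x ≈ y [q^ m ]
≈-weaken {m} {n} {x} {y} m≤n (mod-q^ (r , x-y≡)) = mod-q^ (q ^ᴿ (n ∸ m) *ᴿ r , (begin
  x -ᴿ y                          ≡⟨ x-y≡ ⟩
  q ^ᴿ n *ᴿ r                     ≡⟨ cong (λ k → q ^ᴿ k *ᴿ r) (ℕP.m+[n∸m]≡n m≤n) ⟨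
  q ^ᴿ (m + (n ∸ m)) *ᴿ r         ≡⟨ cong (_*ᴿ r) (^ᴿ-homo-* q m (n ∸ m)) ⟩
  q ^ᴿ m *ᴿ q ^ᴿ (n ∸ m) *ᴿ r     ≡⟨ *-assoc (q ^ᴿ m) _ r ⟩
  q ^ᴿ m *ᴿ (q ^ᴿ (n ∸ m) *ᴿ r)   ∎))
  where open ≡-Reasoning

≈-setoid : ℕ → Setoid 0ℓ 0ℓ
≈-setoid n = record
  { Carrier = ℤ√2
  ; _≈_ = λ x y → x ≈ y [q^ n ]
  ; isEquivalence = record { refl = ≈-refl ; sym = ≈-sym ; trans = ≈-trans }
  }

module ≈-Reasoning (n : ℕ) = SetoidReasoning (≈-setoid n)

-- Parity and exact levels

Odd : ℤ√2 → Set
Odd x = x ≈ 1ᴿ [q^ 1 ]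

≈-by-q* : ∀ {x} y r → x ≡ y +ᴿ q *ᴿ r → x ≈ y [q^ 1 ]
≈-by-q* y r refl = mod-q^ (r , difference y r)
  where
  difference : ∀ y r → (y +ᴿ q *ᴿ r) -ᴿ y ≡ (q *ᴿ 1ᴿ) *ᴿ r
  difference = solve-∀ ℤ√2-ring

re-q* : ∀ r → re (q *ᴿ r) ≡ + 2 ℤ.* im r
re-q* ⟨ c , d ⟩ = simplify c d
  where
  simplify : ∀ c d → + 0 ℤ.* c ℤ.+ + 2 ℤ.* (+ 1 ℤ.* d) ≡ + 2 ℤ.* d
  simplify = ℤ-Solver.solve-∀

im-q* : ∀ r → im (q *ᴿ r) ≡ re r
im-q* ⟨ c , d ⟩ = simplify c d
  where
  simplify : ∀ c d → + 0 ℤ.* d ℤ.+ + 1 ℤ.* c ≡ c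
  simplify = ℤ-Solver.solve-∀

split-re : ∀ ρ k {a b} → a ≡ ρ ℤ.+ k ℤ.* + 2 → ⟨ a , b ⟩ ≡ ⟨ ρ , + 0 ⟩ +ᴿ q *ᴿ ⟨ b , k ⟩
split-re ρ k {b = b} refl = cong₂ ⟨_,_⟩ (re-parts ρ b k) (im-parts b k)
  where
  re-parts : ∀ ρ b k → ρ ℤ.+ k ℤ.* + 2 ≡ ρ ℤ.+ (+ 0 ℤ.* b ℤ.+ + 2 ℤ.* (+ 1 ℤ.* k))
  re-parts = ℤ-Solver.solve-∀
  im-parts : ∀ b k → b ≡ + 0 ℤ.+ (+ 0 ℤ.* k ℤ.+ + 1 ℤ.* b)
  im-parts = ℤ-Solver.solve-∀

≈0⊎≈1 : ∀ x → x ≈ 0ᴿ [q^ 1 ] ⊎ x ≈ 1ᴿ [q^ 1 ]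
≈0⊎≈1 ⟨ a , b ⟩ with a %ℕ 2 | a≡a%ℕn+[a/ℕn]*n a 2 | n%ℕd<d a 2
... | 0           | a≡ | _ = inj₁ (≈-by-q* 0ᴿ ⟨ b , a /ℕ 2 ⟩ (split-re (+ 0) (a /ℕ 2) a≡))
... | 1           | a≡ | _ = inj₂ (≈-by-q* 1ᴿ ⟨ b , a /ℕ 2 ⟩ (split-re (+ 1) (a /ℕ 2) a≡))
... | suc (suc _) | _  | s≤s (s≤s ())

0≉1 : ¬ 0ᴿ ≈ 1ᴿ [q^ 1 ]
0≉1 (mod-q^ (r , 0-1≡)) = ℕP.even≢odd ∣ im r ∣ 0 (begin
  2 * ∣ im r ∣       ≡⟨ ℤP.abs-* (+ 2) (im r) ⟨
  ∣ + 2 ℤ.* im r ∣   ≡⟨ cong ∣_∣ (re-q* r) ⟨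
  ∣ re (q *ᴿ r) ∣    ≡⟨ cong (λ z → ∣ re z ∣) 0-1≡ ⟨
  ∣ re (0ᴿ -ᴿ 1ᴿ) ∣  ∎)
  where open ≡-Reasoning

q*-injective : ∀ {a b} → q *ᴿ a ≡ q *ᴿ b → a ≡ b
q*-injective {a} {b} qa≡qb = cong₂ ⟨_,_⟩
  (trans (sym (im-q* a)) (trans (cong im qa≡qb) (im-q* b)))
  (ℤP.*-cancelˡ-≡ (+ 2) (im a) (im b) (trans (sym (re-q* a)) (trans (cong re qa≡qb) (re-q* b))))

q^*-injective : ∀ m {a b} → q ^ᴿ m *ᴿ a ≡ q ^ᴿ m *ᴿ b → a ≡ b
q^*-injective zero    {a} {b} e = trans (sym (*-identityˡ a)) (trans e (*-identityˡ b))
q^*-injective (suc m) {a} {b} e =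
  q^*-injective m (q*-injective (trans (sym (*-assoc q (q ^ᴿ m) a)) (trans e (*-assoc q (q ^ᴿ m) b))))

private
  Q*a-Q*b : ∀ Q a b → Q *ᴿ a -ᴿ Q *ᴿ b ≡ Q *ᴿ (a -ᴿ b)
  Q*a-Q*b = solve-∀ ℤ√2-ring

  q^-+ : ∀ k m r → q ^ᴿ m *ᴿ (q ^ᴿ k *ᴿ r) ≡ q ^ᴿ (k + m) *ᴿ r
  q^-+ k m r = trans (swap (q ^ᴿ m) (q ^ᴿ k) r) (cong (_*ᴿ r) (sym (^ᴿ-homo-* q k m)))
    where
    swap : ∀ P Q r → P *ᴿ (Q *ᴿ r) ≡ Q *ᴿ P *ᴿ r
    swap = solve-∀ ℤ√2-ring

q^-scale : ∀ {k a b} m → a ≈ b [q^ k ] → q ^ᴿ m *ᴿ a ≈ q ^ᴿ m *ᴿ b [q^ k + m ]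
q^-scale {k} {a} {b} m (mod-q^ (r , a-b≡)) = mod-q^ (r , (begin
  q ^ᴿ m *ᴿ a -ᴿ q ^ᴿ m *ᴿ b  ≡⟨ Q*a-Q*b (q ^ᴿ m) a b ⟩
  q ^ᴿ m *ᴿ (a -ᴿ b)          ≡⟨ cong (q ^ᴿ m *ᴿ_) a-b≡ ⟩
  q ^ᴿ m *ᴿ (q ^ᴿ k *ᴿ r)     ≡⟨ q^-+ k m r ⟩
  q ^ᴿ (k + m) *ᴿ r           ∎))
  where open ≡-Reasoning

q^-cancel : ∀ {k a b} m → q ^ᴿ m *ᴿ a ≈ q ^ᴿ m *ᴿ b [q^ k + m ] → a ≈ b [q^ k ]
q^-cancel {k} {a} {b} m (mod-q^ (r , e)) = mod-q^ (r , q^*-injective m (begin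
  q ^ᴿ m *ᴿ (a -ᴿ b)          ≡⟨ Q*a-Q*b (q ^ᴿ m) a b ⟨
  q ^ᴿ m *ᴿ a -ᴿ q ^ᴿ m *ᴿ b  ≡⟨ e ⟩
  q ^ᴿ (k + m) *ᴿ r           ≡⟨ q^-+ k m r ⟨
  q ^ᴿ m *ᴿ (q ^ᴿ k *ᴿ r)     ∎))
  where open ≡-Reasoning

record ExactLevel (m : ℕ) (x : ℤ√2) : Set where
  constructor level
  field
    cofactor : ℤ√2
    cofactor-odd : Odd cofactor
    x≡1+q^m*cofactor : x ≡ 1ᴿ +ᴿ q ^ᴿ m *ᴿ cofactor

ExactLevel⇒≈1 : ∀ {m x} → ExactLevel m x → x ≈ 1ᴿ [q^ m ]
ExactLevel⇒≈1 {m} (level y _ refl) = mod-q^ (y , difference (q ^ᴿ m) y)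
  where
  difference : ∀ Q y → 1ᴿ +ᴿ Q *ᴿ y -ᴿ 1ᴿ ≡ Q *ᴿ y
  difference = solve-∀ ℤ√2-ring

ExactLevel⇒≉1 : ∀ {m x} → ExactLevel m x → ¬ x ≈ 1ᴿ [q^ suc m ]
ExactLevel⇒≉1 {m} (level y y-odd refl) x≈1 = 0≉1 (≈-trans (≈-sym y≈0) y-odd)
  where
  1≡1+Q*0 : ∀ Q → 1ᴿ ≡ 1ᴿ +ᴿ Q *ᴿ 0ᴿ
  1≡1+Q*0 = solve-∀ ℤ√2-ring
  y≈0 : y ≈ 0ᴿ [q^ 1 ]
  y≈0 = q^-cancel m (+-cancelˡ 1ᴿ (≈-trans x≈1 (≈-reflexive (1≡1+Q*0 (q ^ᴿ m)))))

square≈1 : ∀ {m x} → ExactLevel (suc m) x → x *ᴿ x ≈ 1ᴿ [q^ 2 + m ]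
square≈1 {m} (level y _ refl) = mod-q^ (q *ᴿ y +ᴿ q ^ᴿ m *ᴿ (y *ᴿ y) , square (q ^ᴿ m) y)
  where
  square : ∀ P y → (1ᴿ +ᴿ q *ᴿ P *ᴿ y) *ᴿ (1ᴿ +ᴿ q *ᴿ P *ᴿ y) -ᴿ 1ᴿ
                 ≡ q *ᴿ (q *ᴿ P) *ᴿ (q *ᴿ y +ᴿ P *ᴿ (y *ᴿ y))
  square = solve-∀ ℤ√2-ring

square-level : ∀ {m x} → ExactLevel (3 + m) x → ExactLevel (5 + m) (x *ᴿ x)
square-level {m} (level y y-odd refl) =
  level (y +ᴿ q *ᴿ z) (≈-trans (≈-by-q* y z refl) y-odd) (square (q ^ᴿ m) y)
  where
  z : ℤ√2
  z = q ^ᴿ m *ᴿ (y *ᴿ y)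
  square : ∀ P y → (1ᴿ +ᴿ q *ᴿ (q *ᴿ (q *ᴿ P)) *ᴿ y) *ᴿ (1ᴿ +ᴿ q *ᴿ (q *ᴿ (q *ᴿ P)) *ᴿ y)
                 ≡ 1ᴿ +ᴿ q *ᴿ (q *ᴿ (q *ᴿ (q *ᴿ (q *ᴿ P)))) *ᴿ (y +ᴿ q *ᴿ (P *ᴿ (y *ᴿ y)))
  square = solve-∀ ℤ√2-ring

odd-power≈ : ∀ {m x} → ExactLevel (suc m) x → ∀ c → x ^ᴿ (1 + c * 2) ≈ x [q^ 2 + m ]
odd-power≈ {x = x} _ zero = ≈-reflexive (*-identityʳ x)
odd-power≈ {m} {x} lvl (suc c) = begin
  x *ᴿ (x *ᴿ x ^ᴿ (1 + c * 2))  ≡⟨ *-assoc x x _ ⟨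
  x *ᴿ x *ᴿ x ^ᴿ (1 + c * 2)    ≈⟨ *-cong (square≈1 lvl) (odd-power≈ lvl c) ⟩
  1ᴿ *ᴿ x                        ≡⟨ *-identityˡ x ⟩
  x                              ∎
  where open ≈-Reasoning (2 + m)

parity : ∀ n → (∃ λ k → n ≡ k * 2) ⊎ (∃ λ k → n ≡ 1 + k * 2)
parity zero = inj₁ (0 , refl)
parity (suc n) with parity n
... | inj₁ (k , refl) = inj₂ (k , refl)
... | inj₂ (k , refl) = inj₁ (suc k , refl)

∣+m-+n∣≡m∸n : ∀ {m n} → n ≤ m → ∣ + m ℤ.- + n ∣ ≡ m ∸ n
∣+m-+n∣≡m∸n {m} {n} n≤m = cong ∣_∣ (trans (ℤP.[+m]-[+n]≡m⊖n m n) (ℤP.⊖-≥ n≤m))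

module _ {n : ℕ} (g : ℤ√2) (K : ℕ) (g^K≈1 : g ^ᴿ K ≈ 1ᴿ [q^ n ]) where

  ^[a+c*K]≈^a : ∀ a c → g ^ᴿ (a + c * K) ≈ g ^ᴿ a [q^ n ]
  ^[a+c*K]≈^a a c = begin
    g ^ᴿ (a + c * K)         ≡⟨ ^ᴿ-homo-* g a (c * K) ⟩
    g ^ᴿ a *ᴿ g ^ᴿ (c * K)   ≡⟨ cong (λ e → g ^ᴿ a *ᴿ g ^ᴿ e) (ℕP.*-comm c K) ⟩
    g ^ᴿ a *ᴿ g ^ᴿ (K * c)   ≡⟨ cong (g ^ᴿ a *ᴿ_) (^ᴿ-assocʳ g K c) ⟨
    g ^ᴿ a *ᴿ (g ^ᴿ K) ^ᴿ c  ≈⟨ *-congˡ (g ^ᴿ a) (^-cong c g^K≈1) ⟩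
    g ^ᴿ a *ᴿ 1ᴿ ^ᴿ c        ≡⟨ cong (g ^ᴿ a *ᴿ_) (1ᴿ^ᴿ c) ⟩
    g ^ᴿ a *ᴿ 1ᴿ             ≡⟨ *-identityʳ (g ^ᴿ a) ⟩
    g ^ᴿ a                   ∎
    where open ≈-Reasoning n

  ^-∣≈1 : ∀ {m} → K ∣ m → g ^ᴿ m ≈ 1ᴿ [q^ n ]
  ^-∣≈1 (divides c refl) = ^[a+c*K]≈^a 0 c

  ^-%≈ : .{{_ : NonZero K}} → ∀ m → g ^ᴿ m ≈ g ^ᴿ (m % K) [q^ n ]
  ^-%≈ m = ≈-trans (≈-reflexive (cong (g ^ᴿ_) (m≡m%n+[m/n]*n m K))) (^[a+c*K]≈^a (m % K) (m / K))

  ^-cong-≤ : ∀ {a a′} → a′ ≤ a → K ∣ a ∸ a′ → g ^ᴿ a ≈ g ^ᴿ a′ [q^ n ]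
  ^-cong-≤ {a} {a′} a′≤a (divides c a∸a′≡) = begin
    g ^ᴿ a                ≡⟨ cong (g ^ᴿ_) (ℕP.m+[n∸m]≡n a′≤a) ⟨
    g ^ᴿ (a′ + (a ∸ a′))  ≡⟨ cong (λ e → g ^ᴿ (a′ + e)) a∸a′≡ ⟩
    g ^ᴿ (a′ + c * K)     ≈⟨ ^[a+c*K]≈^a a′ c ⟩
    g ^ᴿ a′               ∎
    where open ≈-Reasoning n

  ^-cong-mod : ∀ a a′ → a ≡ℕ a′ [mod K ] → g ^ᴿ a ≈ g ^ᴿ a′ [q^ n ]
  ^-cong-mod a a′ K∣a-a′ with ℕP.≤-total a′ a
  ... | inj₁ a′≤a = ^-cong-≤ a′≤a (subst (K ∣_) (∣+m-+n∣≡m∸n a′≤a) K∣a-a′)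
  ... | inj₂ a≤a′ = ≈-sym (^-cong-≤ a≤a′
          (subst (K ∣_) (trans (ℤP.∣i-j∣≡∣j-i∣ (+ a) (+ a′)) (∣+m-+n∣≡m∸n a≤a′)) K∣a-a′))

≡ℕ-mod-of-∣ : ∀ k a a′ → suc k ∣ a + k * a′ → a ≡ℕ a′ [mod suc k ]
≡ℕ-mod-of-∣ k a a′ K∣ =
  ℤ∣.∣⇒∣ᵤ (subst (+ suc k ℤ∣.∣_) difference
    (ℤ∣.∣m∣n⇒∣m-n (ℤ∣.∣ᵤ⇒∣ {+ suc k} {+ (a + k * a′)} K∣) (ℤ∣.∣n⇒∣m*n (+ a′) (ℤ∣.∣-refl {+ suc k}))))
  where
  open ≡-Reasoning
  simplify : ∀ a k a′ → (a ℤ.+ k ℤ.* a′) ℤ.- a′ ℤ.* (+ 1 ℤ.+ k) ≡ a ℤ.- a′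
  simplify = ℤ-Solver.solve-∀
  difference : + (a + k * a′) ℤ.- + a′ ℤ.* + suc k ≡ + a ℤ.- + a′
  difference = begin
    + (a + k * a′) ℤ.- + a′ ℤ.* + suc k
      ≡⟨ cong₂ (λ u v → u ℤ.- + a′ ℤ.* v)
           (trans (ℤP.pos-+ a (k * a′)) (cong (λ z → + a ℤ.+ z) (ℤP.pos-* k a′))) (ℤP.pos-+ 1 k) ⟩
    (+ a ℤ.+ + k ℤ.* + a′) ℤ.- + a′ ℤ.* (+ 1 ℤ.+ + k)  ≡⟨ simplify (+ a) (+ k) (+ a′) ⟩
    + a ℤ.- + a′                                          ∎

record IsOrder (n : ℕ) (g : ℤ√2) (K : ℕ) : Set where
  field
    ^order≈1 : g ^ᴿ K ≈ 1ᴿ [q^ n ]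
    order∣ : ∀ {m} → g ^ᴿ m ≈ 1ᴿ [q^ n ] → K ∣ m
open IsOrder public

IsOrder⇒HasOrderMod : ∀ {n g K} → 0 < K → IsOrder n g K → HasOrderMod n g K
IsOrder⇒HasOrderMod 0<K o = 0<K , witness (^order≈1 o) ,
  λ m 0<m g^m≡1 → ∣⇒≤ {{>-nonZero 0<m}} (order∣ o (mod-q^ g^m≡1))

2^-isOrder : ∀ {n g} k → g ^ᴿ (2 ^ k) ≈ 1ᴿ [q^ n ] →
             (∀ t → t < k → ∃ λ v → 2 + v ≤ n × ExactLevel (suc v) (g ^ᴿ (2 ^ t))) →
             IsOrder n g (2 ^ k)
2^-isOrder {n} {g} k g^2^k≈1 levels = record { ^order≈1 = g^2^k≈1 ; order∣ = 2^j∣ k ℕP.≤-refl }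
  where
  2^j∣ : ∀ j → j ≤ k → ∀ {m} → g ^ᴿ m ≈ 1ᴿ [q^ n ] → 2 ^ j ∣ m
  2^j∣ zero    _   {m} _ = 1∣ m
  2^j∣ (suc j) j<k {m} g^m≈1 with 2^j∣ j (ℕP.<⇒≤ j<k) g^m≈1
  ... | divides c m≡c*2^j with parity c
  ... | inj₁ (d , refl) = divides d (trans m≡c*2^j (ℕP.*-assoc d 2 (2 ^ j)))
  -- For odd d, g^(2^j·d) ≡ g^(2^j) modulo q^(v+2), which is not 1 since v(g^(2^j)) = v + 1.
  ... | inj₂ (d , refl) with levels j j<k
  ... | v , 2+v≤n , lvl = ⊥-elim (ExactLevel⇒≉1 lvl (begin
    g ^ᴿ (2 ^ j)                   ≈⟨ odd-power≈ lvl d ⟨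
    (g ^ᴿ (2 ^ j)) ^ᴿ (1 + d * 2)  ≡⟨ ^ᴿ-assocʳ g (2 ^ j) (1 + d * 2) ⟩
    g ^ᴿ (2 ^ j * (1 + d * 2))     ≡⟨ cong (g ^ᴿ_) (trans (ℕP.*-comm (2 ^ j) _) (sym m≡c*2^j)) ⟩
    g ^ᴿ m                         ≈⟨ ≈-weaken 2+v≤n g^m≈1 ⟩
    1ᴿ                             ∎))
    where open ≈-Reasoning (2 + v)

ℓ₁ : ℕ → ℕ
ℓ₁ 0 = 0
ℓ₁ 1 = 1
ℓ₁ (suc (suc t)) = 4 + t * 2

level-g₁ : ∀ t → ExactLevel (suc (ℓ₁ t)) (g₁ ^ᴿ (2 ^ t))
level-g₁ 0 = level 1ᴿ ≈-refl refl
level-g₁ 1 = level ⟨ + 1 , + 1 ⟩ (mod-q^ (⟨ + 1 , + 0 ⟩ , refl)) refl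
level-g₁ 2 = level ⟨ + 3 , + 2 ⟩ (mod-q^ (⟨ + 2 , + 1 ⟩ , refl)) refl
level-g₁ (suc (suc (suc t))) =
  subst (ExactLevel _) (sym (^ᴿ-2^suc g₁ (2 + t))) (square-level (level-g₁ (suc (suc t))))

ℓ₃ : ℕ → ℕ
ℓ₃ 0 = 1
ℓ₃ (suc t) = 5 + t * 2

level-g₃ : ∀ t → ExactLevel (suc (ℓ₃ t)) (g₃ ^ᴿ (2 ^ t))
level-g₃ 0 = level ⟨ + 1 , + 2 ⟩ (mod-q^ (⟨ + 2 , + 0 ⟩ , refl)) refl
level-g₃ 1 = level ⟨ + 5 , + 3 ⟩ (mod-q^ (⟨ + 3 , + 2 ⟩ , refl)) refl
level-g₃ (suc (suc t)) =
  subst (ExactLevel _) (sym (^ᴿ-2^suc g₃ (1 + t))) (square-level (level-g₃ (suc t)))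

level-g₂ : ExactLevel 2 g₂
level-g₂ = level ⟨ -[1+ 0 ] , + 0 ⟩ (mod-q^ (⟨ + 0 , -[1+ 0 ] ⟩ , refl)) refl

order-g₁-odd : ∀ i → IsOrder (5 + i * 2) g₁ (2 ^ (2 + i))
order-g₁-odd i = 2^-isOrder (2 + i) (ExactLevel⇒≈1 (level-g₁ (2 + i)))
  λ t t<2+i → ℓ₁ t , bound t t<2+i , level-g₁ t
  where
  bound : ∀ t → t < 2 + i → 2 + ℓ₁ t ≤ 5 + i * 2
  bound 0 _ = s≤s (s≤s z≤n)
  bound 1 _ = s≤s (s≤s (s≤s z≤n))
  bound (suc (suc j)) (s≤s (s≤s j<i)) =
    ℕP.+-monoʳ-≤ 5 (ℕP.≤-trans (ℕP.n≤1+n _) (ℕP.*-monoˡ-≤ 2 j<i))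

order-g₁-even : ∀ i → IsOrder (6 + i * 2) g₁ (2 ^ (3 + i))
order-g₁-even i = 2^-isOrder (3 + i) (≈-weaken (ℕP.n≤1+n _) (ExactLevel⇒≈1 (level-g₁ (3 + i))))
  λ t t<3+i → ℓ₁ t , bound t t<3+i , level-g₁ t
  where
  bound : ∀ t → t < 3 + i → 2 + ℓ₁ t ≤ 6 + i * 2
  bound 0 _ = s≤s (s≤s z≤n)
  bound 1 _ = s≤s (s≤s (s≤s z≤n))
  bound (suc (suc j)) (s≤s (s≤s (s≤s j≤i))) = ℕP.+-monoʳ-≤ 6 (ℕP.*-monoˡ-≤ 2 j≤i)

order-g₃ : ∀ i {n} → 5 + i * 2 ≤ n → n ≤ 6 + i * 2 → IsOrder n g₃ (2 ^ (1 + i))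
order-g₃ i {n} lower upper = 2^-isOrder (1 + i) (≈-weaken upper (ExactLevel⇒≈1 (level-g₃ (1 + i))))
  λ t t<1+i → ℓ₃ t , ℕP.≤-trans (bound t t<1+i) lower , level-g₃ t
  where
  bound : ∀ t → t < 1 + i → 2 + ℓ₃ t ≤ 5 + i * 2
  bound 0 _ = s≤s (s≤s (s≤s z≤n))
  bound (suc j) (s≤s j<i) = ℕP.+-monoʳ-≤ 5 (ℕP.*-monoˡ-≤ 2 j<i)

order-g₂ : ∀ {n} → 3 ≤ n → IsOrder n g₂ 2
order-g₂ 3≤n = 2^-isOrder 1 ≈-refl λ { 0 _ → 1 , 3≤n , level-g₂ ; (suc _) (s≤s ()) }

-- Independence

monomial : ℕ → ℕ → ℕ → ℤ√2
monomial a b e = g₁ ^ᴿ a *ᴿ g₂ ^ᴿ b *ᴿ g₃ ^ᴿ e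

monomial-* : ∀ a b e a′ b′ e′ →
             monomial a b e *ᴿ monomial a′ b′ e′ ≡ monomial (a + a′) (b + b′) (e + e′)
monomial-* a b e a′ b′ e′ = begin
  monomial a b e *ᴿ monomial a′ b′ e′
    ≡⟨ regroup (g₁ ^ᴿ a) (g₂ ^ᴿ b) (g₃ ^ᴿ e) (g₁ ^ᴿ a′) (g₂ ^ᴿ b′) (g₃ ^ᴿ e′) ⟩
  (g₁ ^ᴿ a *ᴿ g₁ ^ᴿ a′) *ᴿ (g₂ ^ᴿ b *ᴿ g₂ ^ᴿ b′) *ᴿ (g₃ ^ᴿ e *ᴿ g₃ ^ᴿ e′)
    ≡⟨ cong₂ _*ᴿ_ (cong₂ _*ᴿ_ (^ᴿ-homo-* g₁ a a′) (^ᴿ-homo-* g₂ b b′)) (^ᴿ-homo-* g₃ e e′) ⟨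
  monomial (a + a′) (b + b′) (e + e′) ∎
  where
  open ≡-Reasoning
  regroup : ∀ A B C A′ B′ C′ → (A *ᴿ B *ᴿ C) *ᴿ (A′ *ᴿ B′ *ᴿ C′) ≡ (A *ᴿ A′) *ᴿ (B *ᴿ B′) *ᴿ (C *ᴿ C′)
  regroup = solve-∀ ℤ√2-ring

PowersTrivial : ℕ → ℕ → ℕ → ℕ → Set
PowersTrivial n a b e = g₁ ^ᴿ a ≈ 1ᴿ [q^ n ] × g₂ ^ᴿ b ≈ 1ᴿ [q^ n ] × g₃ ^ᴿ e ≈ 1ᴿ [q^ n ]

Independent : ℕ → Set
Independent n = ∀ a b e → monomial a b e ≈ 1ᴿ [q^ n ] → PowersTrivial n a b e

≈1-mod-q⁵⇒ : ∀ {x} → x ≈ 1ᴿ [q^ 5 ] → + 8 ∣ℤ re (x -ᴿ 1ᴿ) × + 4 ∣ℤ im (x -ᴿ 1ᴿ)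
≈1-mod-q⁵⇒ (mod-q^ (⟨ c , d ⟩ , x-1≡)) =
  ℤ∣.∣⇒∣ᵤ (ℤ∣.divides d (trans (cong re x-1≡) (re-q⁵* c d))) ,
  ℤ∣.∣⇒∣ᵤ (ℤ∣.divides c (trans (cong im x-1≡) (im-q⁵* c d)))
  where
  re-q⁵* : ∀ c d → + 0 ℤ.* c ℤ.+ + 2 ℤ.* (+ 4 ℤ.* d) ≡ d ℤ.* + 8
  re-q⁵* = ℤ-Solver.solve-∀
  im-q⁵* : ∀ c d → + 0 ℤ.* d ℤ.+ + 4 ℤ.* c ≡ c ℤ.* + 4
  im-q⁵* = ℤ-Solver.solve-∀

≉1-mod-q⁵ : ∀ x → False ((8 ∣? ∣ re (x -ᴿ 1ᴿ) ∣) ×-dec (4 ∣? ∣ im (x -ᴿ 1ᴿ) ∣)) → ¬ x ≈ 1ᴿ [q^ 5 ]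
≉1-mod-q⁵ x not-both x≈1 = toWitnessFalse not-both (≈1-mod-q⁵⇒ x≈1)

residues≈1-mod-q⁵ : ∀ {a b e} → a < 4 → b < 2 → e < 2 → monomial a b e ≈ 1ᴿ [q^ 5 ] →
                    a ≡ 0 × b ≡ 0 × e ≡ 0
residues≈1-mod-q⁵ {0} {0} {0} _ _ _ _ = refl , refl , refl
residues≈1-mod-q⁵ {0} {0} {1} _ _ _ c = ⊥-elim (≉1-mod-q⁵ _ _ c)
residues≈1-mod-q⁵ {0} {1} {0} _ _ _ c = ⊥-elim (≉1-mod-q⁵ _ _ c)
residues≈1-mod-q⁵ {0} {1} {1} _ _ _ c = ⊥-elim (≉1-mod-q⁵ _ _ c)
residues≈1-mod-q⁵ {1} {0} {0} _ _ _ c = ⊥-elim (≉1-mod-q⁵ _ _ c)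
residues≈1-mod-q⁵ {1} {0} {1} _ _ _ c = ⊥-elim (≉1-mod-q⁵ _ _ c)
residues≈1-mod-q⁵ {1} {1} {0} _ _ _ c = ⊥-elim (≉1-mod-q⁵ _ _ c)
residues≈1-mod-q⁵ {1} {1} {1} _ _ _ c = ⊥-elim (≉1-mod-q⁵ _ _ c)
residues≈1-mod-q⁵ {2} {0} {0} _ _ _ c = ⊥-elim (≉1-mod-q⁵ _ _ c)
residues≈1-mod-q⁵ {2} {0} {1} _ _ _ c = ⊥-elim (≉1-mod-q⁵ _ _ c)
residues≈1-mod-q⁵ {2} {1} {0} _ _ _ c = ⊥-elim (≉1-mod-q⁵ _ _ c)
residues≈1-mod-q⁵ {2} {1} {1} _ _ _ c = ⊥-elim (≉1-mod-q⁵ _ _ c)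
residues≈1-mod-q⁵ {3} {0} {0} _ _ _ c = ⊥-elim (≉1-mod-q⁵ _ _ c)
residues≈1-mod-q⁵ {3} {0} {1} _ _ _ c = ⊥-elim (≉1-mod-q⁵ _ _ c)
residues≈1-mod-q⁵ {3} {1} {0} _ _ _ c = ⊥-elim (≉1-mod-q⁵ _ _ c)
residues≈1-mod-q⁵ {3} {1} {1} _ _ _ c = ⊥-elim (≉1-mod-q⁵ _ _ c)
residues≈1-mod-q⁵ {suc (suc (suc (suc _)))} (s≤s (s≤s (s≤s (s≤s ())))) _ _ _
residues≈1-mod-q⁵ {b = suc (suc _)} _ (s≤s (s≤s ())) _ _
residues≈1-mod-q⁵ {e = suc (suc _)} _ _ (s≤s (s≤s ())) _

independent-5 : Independent 5
independent-5 a b e c = ≈1-of-residue o₁ a a%4≡0 , ≈1-of-residue o₂ b b%2≡0 , ≈1-of-residue o₃ e e%2≡0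
  where
  o₁ : IsOrder 5 g₁ 4
  o₁ = order-g₁-odd 0
  o₂ : IsOrder 5 g₂ 2
  o₂ = order-g₂ (s≤s (s≤s (s≤s z≤n)))
  o₃ : IsOrder 5 g₃ 2
  o₃ = order-g₃ 0 ℕP.≤-refl (ℕP.n≤1+n 5)
  ≈1-of-residue : ∀ {g K} .{{_ : NonZero K}} → IsOrder 5 g K → ∀ m → m % K ≡ 0 → g ^ᴿ m ≈ 1ᴿ [q^ 5 ]
  ≈1-of-residue {g} {K} o m m%K≡0 = ^-∣≈1 g K (^order≈1 o) (m%n≡0⇒n∣m m K m%K≡0)
  reduced : monomial (a % 4) (b % 2) (e % 2) ≈ 1ᴿ [q^ 5 ]
  reduced = ≈-trans (≈-sym (*-cong (*-cong (^-%≈ g₁ 4 (^order≈1 o₁) a) (^-%≈ g₂ 2 (^order≈1 o₂) b))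
                                   (^-%≈ g₃ 2 (^order≈1 o₃) e))) c
  residues = residues≈1-mod-q⁵ (m%n<n a 4) (m%n<n b 2) (m%n<n e 2) reduced
  a%4≡0 = proj₁ residues
  b%2≡0 = proj₁ (proj₂ residues)
  e%2≡0 = proj₂ (proj₂ residues)

order-lift : ∀ {n N g K m} → IsOrder n g K → g ^ᴿ K ≈ 1ᴿ [q^ N ] →
             g ^ᴿ m ≈ 1ᴿ [q^ n ] → g ^ᴿ m ≈ 1ᴿ [q^ N ]
order-lift {g = g} {K} o g^K≈1 g^m≈1 = ^-∣≈1 g K g^K≈1 (order∣ o g^m≈1)

module _ {n : ℕ} (x y z : ℤ√2) (xyz≈1 : x *ᴿ y *ᴿ z ≈ 1ᴿ [q^ n ]) where

  first-factor≈1 : y ≈ 1ᴿ [q^ n ] → z ≈ 1ᴿ [q^ n ] → x ≈ 1ᴿ [q^ n ]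
  first-factor≈1 y≈1 z≈1 = begin
    x                 ≡⟨ x≡x*1*1 x ⟩
    x *ᴿ 1ᴿ *ᴿ 1ᴿ     ≈⟨ *-cong (*-congˡ x (≈-sym y≈1)) (≈-sym z≈1) ⟩
    x *ᴿ y *ᴿ z       ≈⟨ xyz≈1 ⟩
    1ᴿ                ∎
    where
    open ≈-Reasoning n
    x≡x*1*1 : ∀ x → x ≡ x *ᴿ 1ᴿ *ᴿ 1ᴿ
    x≡x*1*1 = solve-∀ ℤ√2-ring

  last-factor≈1 : x ≈ 1ᴿ [q^ n ] → y ≈ 1ᴿ [q^ n ] → z ≈ 1ᴿ [q^ n ]
  last-factor≈1 x≈1 y≈1 = begin
    z                 ≡⟨ z≡1*1*z z ⟩
    1ᴿ *ᴿ 1ᴿ *ᴿ z     ≈⟨ *-congʳ z (*-cong (≈-sym x≈1) (≈-sym y≈1)) ⟩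
    x *ᴿ y *ᴿ z       ≈⟨ xyz≈1 ⟩
    1ᴿ                ∎
    where
    open ≈-Reasoning n
    z≡1*1*z : ∀ z → z ≡ 1ᴿ *ᴿ 1ᴿ *ᴿ z
    z≡1*1*z = solve-∀ ℤ√2-ring

independent-odd⇒even : ∀ i → Independent (5 + i * 2) → Independent (6 + i * 2)
independent-odd⇒even i ind a b e c =
  first-factor≈1 (g₁ ^ᴿ a) (g₂ ^ᴿ b) (g₃ ^ᴿ e) c g₂^b≈1 g₃^e≈1 , g₂^b≈1 , g₃^e≈1
  where
  lower : PowersTrivial (5 + i * 2) a b e
  lower = ind a b e (≈-weaken (ℕP.n≤1+n _) c)
  g₂^b≈1 : g₂ ^ᴿ b ≈ 1ᴿ [q^ 6 + i * 2 ]
  g₂^b≈1 = order-lift (order-g₂ (s≤s (s≤s (s≤s z≤n)))) ≈-refl (proj₁ (proj₂ lower))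
  g₃^e≈1 : g₃ ^ᴿ e ≈ 1ᴿ [q^ 6 + i * 2 ]
  g₃^e≈1 = order-lift (order-g₃ i ℕP.≤-refl (ℕP.n≤1+n _))
                      (^order≈1 (order-g₃ i (ℕP.n≤1+n _) ℕP.≤-refl)) (proj₂ (proj₂ lower))

independent-even⇒odd : ∀ i → Independent (6 + i * 2) → Independent (7 + i * 2)
independent-even⇒odd i ind a b e c =
  g₁^a≈1 , g₂^b≈1 , last-factor≈1 (g₁ ^ᴿ a) (g₂ ^ᴿ b) (g₃ ^ᴿ e) c g₁^a≈1 g₂^b≈1
  where
  lower : PowersTrivial (6 + i * 2) a b e
  lower = ind a b e (≈-weaken (ℕP.n≤1+n _) c)
  g₁^a≈1 : g₁ ^ᴿ a ≈ 1ᴿ [q^ 7 + i * 2 ]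
  g₁^a≈1 = order-lift (order-g₁-even i) (^order≈1 (order-g₁-odd (suc i))) (proj₁ lower)
  g₂^b≈1 : g₂ ^ᴿ b ≈ 1ᴿ [q^ 7 + i * 2 ]
  g₂^b≈1 = order-lift (order-g₂ (s≤s (s≤s (s≤s z≤n)))) ≈-refl (proj₁ (proj₂ lower))

independent : ∀ i → Independent (5 + i * 2) × Independent (6 + i * 2)
independent zero = independent-5 , independent-odd⇒even 0 independent-5
independent (suc i) = independent-odd , independent-odd⇒even (suc i) independent-odd
  where
  independent-odd = independent-even⇒odd i (proj₂ (independent i))

-- Generation

lift-≈ : ∀ {n x h w} → x ≈ h [q^ n ] → Odd h → ExactLevel n w →
         x ≈ h [q^ suc n ] ⊎ x ≈ h *ᴿ w [q^ suc n ]
lift-≈ {n} {x} {h} (mod-q^ (r , x-h≡)) h-odd (level y y-odd refl) =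
  Sum.map (λ r≈0 → ≈-trans (x≈h+q^n* r≈0) (≈-reflexive (h+Q*0≡h h (q ^ᴿ n))))
          (λ r≈1 → ≈-trans (x≈h+q^n* (≈-trans r≈1 (≈-sym (*-cong h-odd y-odd))))
                           (≈-reflexive (h+Q*hy≡h*[1+Q*y] h (q ^ᴿ n) y)))
          (≈0⊎≈1 r)
  where
  x≈h+q^n* : ∀ {s} → r ≈ s [q^ 1 ] → x ≈ h +ᴿ q ^ᴿ n *ᴿ s [q^ suc n ]
  x≈h+q^n* {s} r≈s = begin
    x                  ≡⟨ x≡h+[x-h] x h ⟩
    h +ᴿ (x -ᴿ h)      ≡⟨ cong (h +ᴿ_) x-h≡ ⟩
    h +ᴿ q ^ᴿ n *ᴿ r   ≈⟨ +-congˡ h (q^-scale n r≈s) ⟩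
    h +ᴿ q ^ᴿ n *ᴿ s   ∎
    where
    open ≈-Reasoning (suc n)
    x≡h+[x-h] : ∀ x h → x ≡ h +ᴿ (x -ᴿ h)
    x≡h+[x-h] = solve-∀ ℤ√2-ring
  h+Q*0≡h : ∀ h Q → h +ᴿ Q *ᴿ 0ᴿ ≡ h
  h+Q*0≡h = solve-∀ ℤ√2-ring
  h+Q*hy≡h*[1+Q*y] : ∀ h Q y → h +ᴿ Q *ᴿ (h *ᴿ y) ≡ h *ᴿ (1ᴿ +ᴿ Q *ᴿ y)
  h+Q*hy≡h*[1+Q*y] = solve-∀ ℤ√2-ring

module _ (P : ℤ√2 → Set) (P-1 : P 1ᴿ) (P-* : ∀ {y z} → P y → P z → P (y *ᴿ z)) where

  generated-by-levels : ∀ n → (∀ m → m < n → ∃ λ w → P w × ExactLevel (suc m) w) →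
                        ∀ {x} → Odd x → ∃ λ h → P h × x ≈ h [q^ suc n ]
  generated-by-levels zero    _      x-odd = 1ᴿ , P-1 , x-odd
  generated-by-levels (suc n) levels x-odd =
    let (h , Ph , x≈h) = generated-by-levels n (λ m m<n → levels m (ℕP.m≤n⇒m≤1+n m<n)) x-odd
        (w , Pw , w-level) = levels n ℕP.≤-refl
        h-odd = ≈-trans (≈-sym (≈-weaken (s≤s z≤n) x≈h)) x-odd
    in Sum.[ (λ x≈h′ → h , Ph , x≈h′) , (λ x≈hw → h *ᴿ w , P-* Ph Pw , x≈hw) ]′
         (lift-≈ x≈h h-odd w-level)

unit⇒odd : ∀ {n x} → IsUnitMod (suc n) x → Odd x
unit⇒odd {n} {x} (y , xy≡1) with ≈0⊎≈1 x
... | inj₂ x-odd = x-odd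
... | inj₁ x≈0 = ⊥-elim (0≉1 (begin
  0ᴿ        ≡⟨ zeroˡ y ⟨
  0ᴿ *ᴿ y   ≈⟨ *-congʳ y (≈-sym x≈0) ⟩
  x *ᴿ y    ≈⟨ ≈-weaken (s≤s z≤n) (mod-q^ {n = suc n} xy≡1) ⟩
  1ᴿ        ∎))
  where open ≈-Reasoning 1

ProductOfUnits : ℤ√2 → Set
ProductOfUnits x = ∃ λ us → All IsUnitR us × x ≡ product us

product-++ : ∀ us vs → product (us ++ vs) ≡ product us *ᴿ product vs
product-++ []       vs = sym (*-identityˡ (product vs))
product-++ (u ∷ us) vs = trans (cong (u *ᴿ_) (product-++ us vs)) (sym (*-assoc u _ _))

ProductOfUnits-* : ∀ {y z} → ProductOfUnits y → ProductOfUnits z → ProductOfUnits (y *ᴿ z)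
ProductOfUnits-* (us , us-units , refl) (vs , vs-units , refl) =
  us ++ vs , ++⁺ us-units vs-units , sym (product-++ us vs)

product-isUnitR : ∀ {us} → All IsUnitR us → IsUnitR (product us)
product-isUnitR [] = 1ᴿ , refl
product-isUnitR {u ∷ us} ((v , uv≡1) ∷ units) =
  let (w , Pw≡1) = product-isUnitR units
  in v *ᴿ w , trans (regroup u (product us) v w) (cong₂ _*ᴿ_ uv≡1 Pw≡1)
  where
  regroup : ∀ u P v w → u *ᴿ P *ᴿ (v *ᴿ w) ≡ u *ᴿ v *ᴿ (P *ᴿ w)
  regroup = solve-∀ ℤ√2-ring

g₁-isUnitR : IsUnitR g₁
g₁-isUnitR = ⟨ -[1+ 0 ] , + 1 ⟩ , refl

units-levels : ∀ m → m < 3 → ∃ λ w → ProductOfUnits w × ExactLevel (suc m) w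
units-levels 0 _ = g₁ , (g₁ ∷ [] , g₁-isUnitR ∷ [] , refl) , level 1ᴿ ≈-refl refl
units-levels 1 _ = g₂ , (g₂ ∷ [] , (g₂ , refl) ∷ [] , refl) , level-g₂
units-levels 2 _ = product us , (us , g₁-isUnitR ∷ g₁-isUnitR ∷ (g₂ , refl) ∷ [] , refl) ,
                   level ⟨ -[1+ 0 ] , -[1+ 0 ] ⟩ (mod-q^ (⟨ -[1+ 0 ] , -[1+ 0 ] ⟩ , refl)) refl
  where us = g₁ ∷ g₁ ∷ g₂ ∷ []
units-levels (suc (suc (suc _))) (s≤s (s≤s (s≤s ())))

units-generate : ∀ n → n ≤ 3 → (x : ℤ√2) → IsUnitMod (suc n) x →
                 ∃ λ us → All IsUnitR us × x ≡ product us [modq^ suc n ]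
units-generate n n≤3 x u =
  let (h , (us , units , h≡) , x≈h) =
        generated-by-levels ProductOfUnits ([] , [] , refl) ProductOfUnits-*
          n (λ m m<n → units-levels m (ℕP.≤-trans m<n n≤3)) (unit⇒odd {n} {x} u)
  in us , units , witness (≈-trans x≈h (≈-reflexive h≡))

character-trivial : ∀ {c ℓ} n →
  ((x : ℤ√2) → IsUnitMod n x → ∃ λ us → All IsUnitR us × x ≡ product us [modq^ n ]) →
  (G : Group c ℓ) (χ : ℤ√2 → Group.Carrier G) → IsCharTrivialOnUnits n G χ →
  (x : ℤ√2) → IsUnitMod n x → Group._≈_ G (χ x) (Group.ε G)
character-trivial n generate G χ (well-defined , _ , trivial-on-units) x u =
  let (us , units , x≡) = generate x u
  in Group.trans G (well-defined x (product us) u x≡)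
                   (trivial-on-units (product us) (product-isUnitR units))

IsMonomial : ℤ√2 → Set
IsMonomial x = ∃ λ a → ∃ λ b → ∃ λ e → x ≡ monomial a b e

IsMonomial-* : ∀ {y z} → IsMonomial y → IsMonomial z → IsMonomial (y *ᴿ z)
IsMonomial-* (a , b , e , refl) (a′ , b′ , e′ , refl) =
  a + a′ , b + b′ , e + e′ , monomial-* a b e a′ b′ e′

monomial-levels : ∀ m → ∃ λ w → IsMonomial w × ExactLevel (suc m) w
monomial-levels 0 = g₁ , (1 , 0 , 0 , refl) , level 1ᴿ ≈-refl refl
monomial-levels 1 = g₂ , (0 , 1 , 0 , refl) , level-g₂
monomial-levels 2 = monomial 2 1 0 , (2 , 1 , 0 , refl) ,
  level ⟨ -[1+ 0 ] , -[1+ 0 ] ⟩ (mod-q^ (⟨ -[1+ 0 ] , -[1+ 0 ] ⟩ , refl)) refl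
monomial-levels 3 = monomial 0 1 1 , (0 , 1 , 1 , refl) ,
  level ⟨ -[1+ 0 ] , -[1+ 0 ] ⟩ (mod-q^ (⟨ -[1+ 0 ] , -[1+ 0 ] ⟩ , refl)) refl
monomial-levels (suc (suc (suc (suc d)))) with parity d
... | inj₁ (j , refl) = g₁ ^ᴿ (2 ^ (2 + j)) , (2 ^ (2 + j) , 0 , 0 , x≡x*1*1 _) , level-g₁ (2 + j)
  where
  x≡x*1*1 : ∀ x → x ≡ x *ᴿ 1ᴿ *ᴿ 1ᴿ
  x≡x*1*1 = solve-∀ ℤ√2-ring
... | inj₂ (j , refl) = g₃ ^ᴿ (2 ^ (1 + j)) , (0 , 0 , 2 ^ (1 + j) , x≡1*1*x _) , level-g₃ (1 + j)
  where
  x≡1*1*x : ∀ x → x ≡ 1ᴿ *ᴿ 1ᴿ *ᴿ x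
  x≡1*1*x = solve-∀ ℤ√2-ring

monomials-generate : ∀ n (x : ℤ√2) → IsUnitMod (suc n) x →
                     ∃ λ a → ∃ λ b → ∃ λ e → x ≡ monomial a b e [modq^ suc n ]
monomials-generate n x u =
  let (h , (a , b , e , h≡) , x≈h) =
        generated-by-levels IsMonomial (0 , 0 , 0 , refl) IsMonomial-*
          n (λ m _ → monomial-levels m) (unit⇒odd {n} {x} u)
  in a , b , e , witness (≈-trans x≈h (≈-reflexive h≡))

decomposition : ∀ {n K₁ K₃ K₂} → 0 < K₁ → 0 < K₃ → 0 < K₂ →
  IsOrder n g₁ K₁ → IsOrder n g₃ K₃ → IsOrder n g₂ K₂ → Independent n →
  ((x : ℤ√2) → IsUnitMod n x → ∃ λ a → ∃ λ b → ∃ λ e → x ≡ monomial a b e [modq^ n ]) →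
  ∃ λ (f : ℕ × ℕ × ℕ → ℤ√2) →
      ((t : ℕ × ℕ × ℕ) → IsUnitMod n (f t))
    × ((s t : ℕ × ℕ × ℕ) → f (s +ₜ t) ≡ f s *ᴿ f t [modq^ n ])
    × ((s t : ℕ × ℕ × ℕ) → (f s ≡ f t [modq^ n ]) ⇔ (s ≡ₜ t [mod K₁ , K₃ , K₂ ]))
    × ((x : ℤ√2) → IsUnitMod n x → ∃ λ t → x ≡ f t [modq^ n ])
decomposition {n} {suc k₁} {suc k₃} {suc k₂} _ _ _ o₁ o₃ o₂ independent surjective =
  φ , (λ t → φ (inverse t) , witness (φ-inverse t)) , (λ s t → witness (≈-reflexive {n} (φ-+ s t))) ,
  (λ s t → mk⇔ (λ φs≡φt → φ-injective s t (mod-q^ φs≡φt)) (λ s≡t → witness (φ-cong s t s≡t))) ,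
  φ-surjective
  where
  φ : ℕ × ℕ × ℕ → ℤ√2
  φ (a , b , e) = monomial a e b

  inverse : ℕ × ℕ × ℕ → ℕ × ℕ × ℕ
  inverse (a , b , e) = (k₁ * a , k₃ * b , k₂ * e)

  φ-+ : ∀ s t → φ (s +ₜ t) ≡ φ s *ᴿ φ t
  φ-+ (a , b , e) (a′ , b′ , e′) = sym (monomial-* a e b a′ e′ b′)

  φ-inverse : ∀ t → φ t *ᴿ φ (inverse t) ≈ 1ᴿ [q^ n ]
  φ-inverse t@(a , b , e) = begin
    φ t *ᴿ φ (inverse t)      ≡⟨ φ-+ t (inverse t) ⟨
    φ (t +ₜ inverse t)        ≈⟨ *-cong (*-cong (^-∣≈1 g₁ (suc k₁) (^order≈1 o₁) (m∣m*n a))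
                                                (^-∣≈1 g₂ (suc k₂) (^order≈1 o₂) (m∣m*n e)))
                                        (^-∣≈1 g₃ (suc k₃) (^order≈1 o₃) (m∣m*n b)) ⟩
    1ᴿ                        ∎
    where open ≈-Reasoning n

  φ-injective : ∀ s t → φ s ≈ φ t [q^ n ] → s ≡ₜ t [mod suc k₁ , suc k₃ , suc k₂ ]
  φ-injective s@(a , b , e) t@(a′ , b′ , e′) φs≈φt =
    ≡ℕ-mod-of-∣ k₁ a a′ (order∣ o₁ (proj₁ trivial)) ,
    ≡ℕ-mod-of-∣ k₃ b b′ (order∣ o₃ (proj₂ (proj₂ trivial))) ,
    ≡ℕ-mod-of-∣ k₂ e e′ (order∣ o₂ (proj₁ (proj₂ trivial)))
    where
    trivial : PowersTrivial n (a + k₁ * a′) (e + k₂ * e′) (b + k₃ * b′)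
    trivial = independent (a + k₁ * a′) (e + k₂ * e′) (b + k₃ * b′) (begin
      φ (s +ₜ inverse t)        ≡⟨ φ-+ s (inverse t) ⟩
      φ s *ᴿ φ (inverse t)      ≈⟨ *-congʳ (φ (inverse t)) φs≈φt ⟩
      φ t *ᴿ φ (inverse t)      ≈⟨ φ-inverse t ⟩
      1ᴿ                        ∎)
      where open ≈-Reasoning n

  φ-cong : ∀ s t → s ≡ₜ t [mod suc k₁ , suc k₃ , suc k₂ ] → φ s ≈ φ t [q^ n ]
  φ-cong (a , b , e) (a′ , b′ , e′) (a≡a′ , b≡b′ , e≡e′) =
    *-cong (*-cong (^-cong-mod g₁ (suc k₁) (^order≈1 o₁) a a′ a≡a′)
                   (^-cong-mod g₂ (suc k₂) (^order≈1 o₂) e e′ e≡e′))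
           (^-cong-mod g₃ (suc k₃) (^order≈1 o₃) b b′ b≡b′)

  φ-surjective : (x : ℤ√2) → IsUnitMod n x → ∃ λ t → x ≡ φ t [modq^ n ]
  φ-surjective x u = let (a , b , e , x≡) = surjective x u in (a , e , b) , x≡

record UnitGroupStructure (n k l : ℕ) : Set where
  field
    order₁ : IsOrder n g₁ (2 ^ k)
    order₃ : IsOrder n g₃ (2 ^ l)
    independence : Independent n

[m+i*2]/2 : ∀ m i → (m + i * 2) / 2 ≡ m / 2 + i
[m+i*2]/2 m i = trans (+-distrib-/-∣ʳ m (divides i refl)) (cong (λ k → m / 2 + k) (m*n/n≡m i 2))

unitGroupStructure : ∀ n → 4 < n → UnitGroupStructure n (n / 2) ((n ∸ 3) / 2)
unitGroupStructure (suc (suc (suc (suc (suc d))))) (s≤s (s≤s (s≤s (s≤s (s≤s z≤n))))) with parity d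
... | inj₁ (i , refl) =
  subst₂ (UnitGroupStructure (5 + i * 2)) (sym ([m+i*2]/2 5 i)) (sym ([m+i*2]/2 2 i)) record
  { order₁ = order-g₁-odd i
  ; order₃ = order-g₃ i ℕP.≤-refl (ℕP.n≤1+n _)
  ; independence = proj₁ (independent i)
  }
... | inj₂ (i , refl) =
  subst₂ (UnitGroupStructure (6 + i * 2)) (sym ([m+i*2]/2 6 i)) (sym ([m+i*2]/2 3 i)) record
  { order₁ = order-g₁-even i
  ; order₃ = order-g₃ i (ℕP.n≤1+n _) ℕP.≤-refl
  ; independence = proj₂ (independent i)
  }

proposition6p1 : ∀ {c ℓ} →
    -- Case 1 ≤ n ≤ 4
    ((n : ℕ) → 1 ≤ n → n ≤ 4 →
        -- U_n is generated by the images of the units of R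
        ((x : ℤ√2) → IsUnitMod n x →
          ∃ λ us → All IsUnitR us × x ≡ product us [modq^ n ])
      × -- hence every character of U_n trivial on the image of R^× is trivial
        ((G : Group c ℓ) (χ : ℤ√2 → Group.Carrier G) → IsCharTrivialOnUnits n G χ →
          (x : ℤ√2) → IsUnitMod n x → Group._≈_ G (χ x) (Group.ε G)))
  × -- Case n > 4
    ((n : ℕ) → 4 < n →
        -- (1) U_n = <1+q> ⊕ <-1> ⊕ <3+4q>
        ((x : ℤ√2) → IsUnitMod n x →
          ∃ λ a → ∃ λ b → ∃ λ e → x ≡ g₁ ^ᴿ a *ᴿ g₂ ^ᴿ b *ᴿ g₃ ^ᴿ e [modq^ n ])
      × ((a b e : ℕ) → g₁ ^ᴿ a *ᴿ g₂ ^ᴿ b *ᴿ g₃ ^ᴿ e ≡ 1ᴿ [modq^ n ] →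
          (g₁ ^ᴿ a ≡ 1ᴿ [modq^ n ]) × (g₂ ^ᴿ b ≡ 1ᴿ [modq^ n ]) × (g₃ ^ᴿ e ≡ 1ᴿ [modq^ n ]))
        -- (2) orders of 1+q and 3+4q
      × HasOrderMod n g₁ (2 ^ (n / 2))
      × HasOrderMod n g₃ (2 ^ ((n ∸ 3) / 2))
        -- (3) U_n ≅ Z/2^k ⊕ Z/2^l ⊕ Z/2 with k = ⌊n/2⌋, l = ⌊(n-3)/2⌋
      × (∃ λ (f : ℕ × ℕ × ℕ → ℤ√2) →
            ((t : ℕ × ℕ × ℕ) → IsUnitMod n (f t))
          × ((s t : ℕ × ℕ × ℕ) → f (s +ₜ t) ≡ f s *ᴿ f t [modq^ n ])
          × ((s t : ℕ × ℕ × ℕ) →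
               (f s ≡ f t [modq^ n ]) ⇔ (s ≡ₜ t [mod 2 ^ (n / 2) , 2 ^ ((n ∸ 3) / 2) , 2 ]))
          × ((x : ℤ√2) → IsUnitMod n x → ∃ λ t → x ≡ f t [modq^ n ])))
proposition6p1 =
    (λ { zero ()
       ; (suc n) _ 1+n≤4 → let generate = units-generate n (ℕP.≤-pred 1+n≤4) in
           generate , character-trivial (suc n) generate })
  , λ { zero ()
      ; (suc n) 4<n →
          let open UnitGroupStructure (unitGroupStructure (suc n) 4<n)
              2^k>0 = ℕP.m^n>0 2 (suc n / 2)
              2^l>0 = ℕP.m^n>0 2 ((suc n ∸ 3) / 2)
          in monomials-generate n
           , (λ a b e c → let (g₁^a≈1 , g₂^b≈1 , g₃^e≈1) = independence a b e (mod-q^ c)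
                          in witness g₁^a≈1 , witness g₂^b≈1 , witness g₃^e≈1)
           , IsOrder⇒HasOrderMod 2^k>0 order₁
           , IsOrder⇒HasOrderMod 2^l>0 order₃
           , decomposition 2^k>0 2^l>0 (s≤s z≤n) order₁ order₃
               (order-g₂ (ℕP.≤-trans (s≤s (s≤s (s≤s z≤n))) 4<n)) independence (monomials-generate n) }
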